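{- Let $\mathcal{M}$ be a regular maniplex of rank $n$, let $\Phi$ be a flag of $\mathcal{M}$, let $\mathrm{Aut}(\mathcal{M})=\langle \rho_0,\ldots,\rho_{n-1}\mid \mathcal{R}\rangle$ be a presentation of $\mathrm{Aut}(\mathcal{M})$ in terms of the standard generators $\rho_0,\ldots,\rho_{n-1}$ with respect to the base flag $\Phi$, and let $\mathcal{I}\subseteq\{0,\ldots,n-1\}$. Suppose that for every $i\notin\mathcal{I}$, every relator in $\mathcal{R}$ contains an even number of symbols $\rho_i$. Then $\mathcal{M}$ admits a bi-colouring consistent with $\mathcal{I}$.
   Context: An $n$-maniplex is a pair $(\mathcal{F},\{r_0,\ldots,r_{n-1}\})$ where $\mathcal{F}$ is a non-empty set of flags and $r_0,\ldots,r_{n-1}$ are fixed-point-free involutory permutations of $\mathcal{F}$ such that $\langle r_0,\ldots,r_{n-1}\rangle$ is transitive on $\mathcal{F}$, $\Phi^{r_i}\neq\Phi^{r_j}$ for all flags $\Phi$ and $i\ne j$, and $r_ir_j=r_jr_i$ whenever $|i-j|\geq 2$. Flags $\Phi,\Phi^{r_i}$ are $i$-adjacent. An automorphism is a permutation of $\mathcal{F}$ commuting with every $r_i$; the maniplex is regular if $\mathrm{Aut}(\mathcal{M})$ is transitive on flags (then it acts regularly). Given a base flag $\Phi$ of a regular maniplex, the standard generators are the automorphisms $\rho_i$ with $\Phi^{\rho_i}=\Phi^{r_i}$, $i=0,\ldots,n-1$; they generate $\mathrm{Aut}(\mathcal{M})$. A bi-colouring consistent with $\mathcal{I}$ is a colouring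 of the flags black and white such that $i$-adjacent flags have the same colour if and only if $i\in\mathcal{I}$. -}

module Defs where

open import Level using (0ℓ)
open import Data.Nat using (ℕ; zero; suc; _≥_)
open import Data.Nat.Divisibility using (_∣_)
open import Data.Fin using (Fin; toℕ)
open import Data.Bool using (Bool; true; false)
open import Data.List using (List; []; _∷_; _++_)
open import Data.Product using (_×_; _,_; ∃; ∃-syntax)
open import Data.Integer using (∣_∣; _-_; +_)
open import Relation.Binary.PropositionalEquality using (_≡_)
open import Relation.Nullary using (¬_)
open import Function using (_∘_; id; _⇔_)
open import Data.Fin.Subset using (Subset; _∈_)

dist : ∀ {n} → Fin n → Fin n → ℕ
dist i j = ∣ + toℕ i - + toℕ j ∣

-- apply a list of adjacency permutations (right action: first letter first)
applyR : ∀ {n} {F : Set} → (Fin n → F → F) → List (Fin n) → F → F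
applyR r []      x = x
applyR r (i ∷ w) x = applyR r w (r i x)

record IsManiplex (n : ℕ) (F : Set) (r : Fin n → F → F) : Set where
  field
    nonempty      : F
    involutive    : ∀ i x → r i (r i x) ≡ x
    fixedPointFree : ∀ i x → ¬ (r i x ≡ x)
    transitive    : ∀ x y → ∃[ w ] applyR r w x ≡ y
    distinctAdj   : ∀ i j x → ¬ (i ≡ j) → ¬ (r i x ≡ r j x)
    commuting     : ∀ i j x → dist i j ≥ 2 → r i (r j x) ≡ r j (r i x)

record Automorphism {n : ℕ} (F : Set) (r : Fin n → F → F) : Set where
  field
    fun      : F → F
    inv      : F → F
    inv-left  : ∀ x → inv (fun x) ≡ x
    inv-right : ∀ x → fun (inv x) ≡ x
    commutes : ∀ i x → fun (r i x) ≡ r i (fun x)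
open Automorphism public

IsRegular : ∀ {n} (F : Set) (r : Fin n → F → F) → Set
IsRegular F r = ∀ x y → ∃[ α ] fun {F = F} {r = r} α x ≡ y

IsStandardGenerators : ∀ {n} {F : Set} {r : Fin n → F → F} →
  F → (Fin n → Automorphism F r) → Set
IsStandardGenerators {r = r} Φ ρ = ∀ i → fun (ρ i) Φ ≡ r i Φ

-- Words in the free group on ρ_0..ρ_{n-1}: letters (i , false) = ρ_i, (i , true) = ρ_i⁻¹.
Letter : ℕ → Set
Letter n = Fin n × Bool

Word : ℕ → Set
Word n = List (Letter n)

invLetter : ∀ {n} → Letter n → Letter n
invLetter (i , b) = (i , Data.Bool.not b)

-- Evaluation of a word as an element of Aut(M), acting on flags
-- (product read left to right, right action).
evalLetter : ∀ {n} {F : Set} {r : Fin n → F → F} →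
  (Fin n → Automorphism F r) → Letter n → F → F
evalLetter ρ (i , false) = fun (ρ i)
evalLetter ρ (i , true)  = inv (ρ i)

evalWord : ∀ {n} {F : Set} {r : Fin n → F → F} →
  (Fin n → Automorphism F r) → Word n → F → F
evalWord ρ []      x = x
evalWord ρ (a ∷ w) x = evalWord ρ w (evalLetter ρ a x)

EvalsToId : ∀ {n} {F : Set} {r : Fin n → F → F} →
  (Fin n → Automorphism F r) → Word n → Set
EvalsToId ρ w = ∀ x → evalWord ρ w x ≡ x

-- Equality in the group ⟨ρ_0..ρ_{n-1} | R⟩: the congruence on words generated
-- by free cancellation and insertion/deletion of relators.
data _≈⟨_⟩_ {n : ℕ} : Word n → (Word n → Set) → Word n → Set₁ where
  ≈-refl   : ∀ {R u} → u ≈⟨ R ⟩ u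
  ≈-sym    : ∀ {R u v} → u ≈⟨ R ⟩ v → v ≈⟨ R ⟩ u
  ≈-trans  : ∀ {R u v w} → u ≈⟨ R ⟩ v → v ≈⟨ R ⟩ w → u ≈⟨ R ⟩ w
  ≈-cancel : ∀ {R} u a v → (u ++ a ∷ invLetter a ∷ v) ≈⟨ R ⟩ (u ++ v)
  ≈-rel    : ∀ {R} u ρ v → R ρ → (u ++ ρ ++ v) ≈⟨ R ⟩ (u ++ v)

-- ⟨ρ_0..ρ_{n-1} | R⟩ is a presentation of Aut(M) in terms of ρ:
-- a word evaluates to the identity iff it is trivial in the presented group.
-- (That ρ generates Aut(M) is part of being a presentation.)
IsPresentation : ∀ {n} {F : Set} {r : Fin n → F → F} →
  (Fin n → Automorphism F r) → (Word n → Set) → Set₁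
IsPresentation {n} {F} {r} ρ R =
  (∀ (α : Automorphism F r) → ∃[ w ] (∀ x → evalWord ρ w x ≡ fun α x))
  × (∀ w → EvalsToId ρ w ⇔ (w ≈⟨ R ⟩ []))

count : ∀ {n} → Fin n → Word n → ℕ
count i [] = 0
count i ((j , _) ∷ w) with Data.Fin._≟_ i j
... | Relation.Nullary.yes _ = suc (count i w)
... | Relation.Nullary.no _  = count i w

IsBiColouring : ∀ {n} {F : Set} → (Fin n → F → F) → Subset n → (F → Bool) → Set
IsBiColouring r I c = ∀ i x → (c (r i x) ≡ c x) ⇔ (i ∈ I)

-- Give the generators the weights 1 for i ∉ I and 0 for i ∈ I, and colour a flag by the
-- total weight, modulo 2, of any word in the ρ's carrying the base flag Φ to it. Two such
-- words u, v differ by the word u v⁻¹, which fixes Φ, hence (the maniplex being connected)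
-- is the identity automorphism, hence reduces to the empty word by free cancellations and
-- insertions and deletions of relators; by hypothesis none of these changes the weight mod 2.
-- Since ρ_i sends Φ to its i-adjacent flag, prefixing ρ_i to a word for x gives a word for
-- the i-adjacent flag of x, so crossing an i-edge changes the colour exactly when i ∉ I.
module Submission where

open import Defs
open import Data.Nat.Base using (ℕ; zero; suc; parity)
open import Data.Nat.Divisibility using (_∣_; divides)
open import Data.Fin using (Fin; zero; suc; _≟_)
open import Data.Fin.Subset using (Subset; _∉_; _∈_)
open import Data.Fin.Subset.Properties using (_∈?_)
open import Data.Bool using (Bool; true; false; not)
open import Data.Parity.Base using (Parity; 0ℙ; 1ℙ; _+_; _*_)
open import Data.Parity.Properties
  using (+-identityʳ; +-homo-+; *-homo-*; *-zeroʳ; *-distribʳ-+; +-assoc; +-comm; +-cancelʳ-≡; p+p≡0ℙ; +-0-commutativeMonoid)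
open import Algebra.Properties.CommutativeMonoid.Sum +-0-commutativeMonoid
  using (sum-syntax; sum-cong-≗; sum-replicate-zero; ∑-distrib-+)
open import Data.Product using (∃-syntax; _,_; proj₁; proj₂)
open import Data.List using (List; []; _∷_; _++_; [_])
open import Relation.Nullary using (yes; no; ¬_)
open import Relation.Binary.PropositionalEquality using (_≡_; refl; sym; trans; cong; cong₂; module ≡-Reasoning)
open import Data.Empty using (⊥-elim)
open import Function using (_∘_; _⇔_; mk⇔; Equivalence)
open import Function.Construct.Composition using (_⇔-∘_)

private
  variable
    n : ℕ

2∣⇒parity≡0ℙ : ∀ {k} → 2 ∣ k → parity k ≡ 0ℙ
2∣⇒parity≡0ℙ (divides q refl) = trans (*-homo-* q 2) (*-zeroʳ (parity q))

p+q≡0ℙ⇒p≡q : ∀ p q → p + q ≡ 0ℙ → p ≡ q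
p+q≡0ℙ⇒p≡q p q p+q≡0ℙ = +-cancelʳ-≡ q p q (trans p+q≡0ℙ (sym (p+p≡0ℙ q)))

δ : Fin n → Fin n → Parity
δ zero    zero    = 1ℙ
δ zero    (suc _) = 0ℙ
δ (suc _) zero    = 0ℙ
δ (suc j) (suc i) = δ j i

δ-diag : (i : Fin n) → δ i i ≡ 1ℙ
δ-diag zero    = refl
δ-diag (suc i) = δ-diag i

δ-offdiag : (j i : Fin n) → ¬ j ≡ i → δ j i ≡ 0ℙ
δ-offdiag zero    zero    j≢i = ⊥-elim (j≢i refl)
δ-offdiag zero    (suc i) j≢i = refl
δ-offdiag (suc j) zero    j≢i = refl
δ-offdiag (suc j) (suc i) j≢i = δ-offdiag j i (j≢i ∘ cong suc)

∑-δ : (f : Fin n → Parity) (i : Fin n) → ∑[ j < n ] (δ j i * f j) ≡ f i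
∑-δ {suc n} f zero    = trans (cong (f zero +_) (sum-replicate-zero n)) (+-identityʳ (f zero))
∑-δ {suc n} f (suc i) = ∑-δ (λ j → f (suc j)) i

parity-count-∷ : (j i : Fin n) (b : Bool) (w : Word n) →
                 parity (count j ((i , b) ∷ w)) ≡ δ j i + parity (count j w)
parity-count-∷ j i b w with j ≟ i
... | yes refl = trans (+-homo-+ 1 (count j w)) (cong (_+ parity (count j w)) (sym (δ-diag j)))
... | no j≢i   = cong (_+ parity (count j w)) (sym (δ-offdiag j i j≢i))

weight : (Fin n → Parity) → Word n → Parity
weight f []            = 0ℙ
weight f ((i , _) ∷ w) = f i + weight f w

module _ (f : Fin n → Parity) where

  weight-++ : (u v : Word n) → weight f (u ++ v) ≡ weight f u + weight f v
  weight-++ []            v = refl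
  weight-++ ((i , _) ∷ u) v = trans (cong (f i +_) (weight-++ u v)) (sym (+-assoc (f i) _ _))

  weight-cancel : (a : Letter n) (v : Word n) → weight f (a ∷ invLetter a ∷ v) ≡ weight f v
  weight-cancel (i , _) v =
    trans (sym (+-assoc (f i) (f i) (weight f v))) (cong (_+ weight f v) (p+p≡0ℙ (f i)))

  weight-resp-≈ : {R : Word n → Set} → (∀ w → R w → weight f w ≡ 0ℙ) →
                  ∀ {u v} → u ≈⟨ R ⟩ v → weight f u ≡ weight f v
  weight-resp-≈ R⇒0 ≈-refl            = refl
  weight-resp-≈ R⇒0 (≈-sym u≈v)       = sym (weight-resp-≈ R⇒0 u≈v)
  weight-resp-≈ R⇒0 (≈-trans u≈v v≈w) = trans (weight-resp-≈ R⇒0 u≈v) (weight-resp-≈ R⇒0 v≈w)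
  weight-resp-≈ R⇒0 (≈-cancel u a v)  = begin
    weight f (u ++ a ∷ invLetter a ∷ v)          ≡⟨ weight-++ u (a ∷ invLetter a ∷ v) ⟩
    weight f u + weight f (a ∷ invLetter a ∷ v)  ≡⟨ cong (weight f u +_) (weight-cancel a v) ⟩
    weight f u + weight f v                      ≡⟨ weight-++ u v ⟨
    weight f (u ++ v)                            ∎
    where open ≡-Reasoning
  weight-resp-≈ R⇒0 (≈-rel u r v Rr)  = begin
    weight f (u ++ r ++ v)                    ≡⟨ weight-++ u (r ++ v) ⟩
    weight f u + weight f (r ++ v)            ≡⟨ cong (weight f u +_) (weight-++ r v) ⟩
    weight f u + (weight f r + weight f v)    ≡⟨ cong (λ p → weight f u + (p + weight f v)) (R⇒0 r Rr) ⟩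
    weight f u + weight f v                   ≡⟨ weight-++ u v ⟨
    weight f (u ++ v)                         ∎
    where open ≡-Reasoning

  -- The parity _+_ and _*_ are both infixl 7, hence the explicit parentheses.
  weight≡∑ : (w : Word n) → weight f w ≡ ∑[ j < n ] (parity (count j w) * f j)
  weight≡∑ []            = sym (sum-replicate-zero n)
  weight≡∑ ((i , b) ∷ w) = begin
    f i + weight f w
      ≡⟨ cong₂ _+_ (sym (∑-δ f i)) (weight≡∑ w) ⟩
    ∑[ j < n ] (δ j i * f j) + ∑[ j < n ] (parity (count j w) * f j)
      ≡⟨ ∑-distrib-+ (λ j → δ j i * f j) (λ j → parity (count j w) * f j) ⟨
    ∑[ j < n ] ((δ j i * f j) + (parity (count j w) * f j))
      ≡⟨ sum-cong-≗ (λ j → *-distribʳ-+ (f j) (δ j i) (parity (count j w))) ⟨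
    ∑[ j < n ] ((δ j i + parity (count j w)) * f j)
      ≡⟨ sum-cong-≗ (λ j → cong (_* f j) (parity-count-∷ j i b w)) ⟨
    ∑[ j < n ] (parity (count j ((i , b) ∷ w)) * f j)
      ∎
    where open ≡-Reasoning

invWord : Word n → Word n
invWord []      = []
invWord (a ∷ w) = invWord w ++ [ invLetter a ]

weight-invWord : (f : Fin n → Parity) (w : Word n) → weight f (invWord w) ≡ weight f w
weight-invWord f []            = refl
weight-invWord f ((i , b) ∷ w) = begin
  weight f (invWord w ++ [ (i , not b) ])  ≡⟨ weight-++ f (invWord w) [ (i , not b) ] ⟩
  weight f (invWord w) + (f i + 0ℙ)        ≡⟨ cong₂ _+_ (weight-invWord f w) (+-identityʳ (f i)) ⟩
  weight f w + f i                         ≡⟨ +-comm (weight f w) (f i) ⟩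
  f i + weight f w                         ∎
  where open ≡-Reasoning

module _ {F : Set} {r : Fin n → F → F} where

  inv-commutes : (α : Automorphism F r) (i : Fin n) (x : F) → inv α (r i x) ≡ r i (inv α x)
  inv-commutes α i x = begin
    inv α (r i x)                  ≡⟨ cong (inv α ∘ r i) (inv-right α x) ⟨
    inv α (r i (fun α (inv α x)))  ≡⟨ cong (inv α) (commutes α i (inv α x)) ⟨
    inv α (fun α (r i (inv α x)))  ≡⟨ inv-left α (r i (inv α x)) ⟩
    r i (inv α x)                  ∎
    where open ≡-Reasoning

  module _ (ρ : Fin n → Automorphism F r) where

    evalLetter-commutes : (a : Letter n) (i : Fin n) (x : F) →
                          evalLetter ρ a (r i x) ≡ r i (evalLetter ρ a x)
    evalLetter-commutes (k , false) = commutes (ρ k)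
    evalLetter-commutes (k , true)  = inv-commutes (ρ k)

    evalWord-commutes : (w : Word n) (i : Fin n) (x : F) →
                        evalWord ρ w (r i x) ≡ r i (evalWord ρ w x)
    evalWord-commutes []      i x = refl
    evalWord-commutes (a ∷ w) i x =
      trans (cong (evalWord ρ w) (evalLetter-commutes a i x)) (evalWord-commutes w i (evalLetter ρ a x))

    evalWord-applyR : (w : Word n) (u : List (Fin n)) (x : F) →
                      evalWord ρ w (applyR r u x) ≡ applyR r u (evalWord ρ w x)
    evalWord-applyR w []      x = refl
    evalWord-applyR w (i ∷ u) x =
      trans (evalWord-applyR w u (r i x)) (cong (applyR r u) (evalWord-commutes w i x))

    evalWord-++ : (u v : Word n) (x : F) → evalWord ρ (u ++ v) x ≡ evalWord ρ v (evalWord ρ u x)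
    evalWord-++ []      v x = refl
    evalWord-++ (a ∷ u) v x = evalWord-++ u v (evalLetter ρ a x)

    evalLetter-invLetter : (a : Letter n) (x : F) → evalLetter ρ (invLetter a) (evalLetter ρ a x) ≡ x
    evalLetter-invLetter (k , false) = inv-left (ρ k)
    evalLetter-invLetter (k , true)  = inv-right (ρ k)

    evalWord-invWord : (w : Word n) (x : F) → evalWord ρ (invWord w) (evalWord ρ w x) ≡ x
    evalWord-invWord []      x = refl
    evalWord-invWord (a ∷ w) x = begin
      evalWord ρ (invWord w ++ [ invLetter a ]) (evalWord ρ w (evalLetter ρ a x))
        ≡⟨ evalWord-++ (invWord w) [ invLetter a ] _ ⟩
      evalLetter ρ (invLetter a) (evalWord ρ (invWord w) (evalWord ρ w (evalLetter ρ a x)))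
        ≡⟨ cong (evalLetter ρ (invLetter a)) (evalWord-invWord w (evalLetter ρ a x)) ⟩
      evalLetter ρ (invLetter a) (evalLetter ρ a x)
        ≡⟨ evalLetter-invLetter a x ⟩
      x ∎
      where open ≡-Reasoning

    fixes-flag⇒EvalsToId : (∀ x y → ∃[ u ] applyR r u x ≡ y) →
                           ∀ {Φ} w → evalWord ρ w Φ ≡ Φ → EvalsToId ρ w
    fixes-flag⇒EvalsToId connected {Φ} w wΦ≡Φ y with connected Φ y
    ... | u , refl = trans (evalWord-applyR w u Φ) (cong (applyR r u) wΦ≡Φ)

module ParityColouring
  {F : Set} {r : Fin n → F → F} (M : IsManiplex n F r) (regular : IsRegular F r)
  {Φ : F} {ρ : Fin n → Automorphism F r} (standard : IsStandardGenerators Φ ρ)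
  {R : Word n → Set} (presentation : IsPresentation ρ R)
  (f : Fin n → Parity) (relator-weight : ∀ w → R w → weight f w ≡ 0ℙ)
  where

  open IsManiplex M using (transitive)

  weight-determined-by-image : (u v : Word n) → evalWord ρ u Φ ≡ evalWord ρ v Φ →
                               weight f u ≡ weight f v
  weight-determined-by-image u v uΦ≡vΦ = p+q≡0ℙ⇒p≡q (weight f u) (weight f v) (begin
    weight f u + weight f v            ≡⟨ cong (weight f u +_) (weight-invWord f v) ⟨
    weight f u + weight f (invWord v)  ≡⟨ weight-++ f u (invWord v) ⟨
    weight f (u ++ invWord v)          ≡⟨ weight-resp-≈ f relator-weight u⁻v≈[] ⟩
    0ℙ                                 ∎)
    where
    open ≡-Reasoning
    u⁻vΦ≡Φ : evalWord ρ (u ++ invWord v) Φ ≡ Φ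
    u⁻vΦ≡Φ = trans (evalWord-++ ρ u (invWord v) Φ)
                   (trans (cong (evalWord ρ (invWord v)) uΦ≡vΦ) (evalWord-invWord ρ v Φ))
    u⁻v≈[] : (u ++ invWord v) ≈⟨ R ⟩ []
    u⁻v≈[] = Equivalence.to (proj₂ presentation (u ++ invWord v))
                            (fixes-flag⇒EvalsToId ρ transitive (u ++ invWord v) u⁻vΦ≡Φ)

  wordTo : F → Word n
  wordTo x = proj₁ (proj₁ presentation (proj₁ (regular Φ x)))

  evalWord-wordTo : (x : F) → evalWord ρ (wordTo x) Φ ≡ x
  evalWord-wordTo x = trans (proj₂ (proj₁ presentation α) Φ) (proj₂ (regular Φ x))
    where α = proj₁ (regular Φ x)

  colour : F → Parity
  colour x = weight f (wordTo x)

  colour-adjacent : (i : Fin n) (x : F) → colour (r i x) ≡ f i + colour x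
  colour-adjacent i x = weight-determined-by-image (wordTo (r i x)) ((i , false) ∷ wordTo x) (begin
    evalWord ρ (wordTo (r i x)) Φ      ≡⟨ evalWord-wordTo (r i x) ⟩
    r i x                              ≡⟨ cong (r i) (evalWord-wordTo x) ⟨
    r i (evalWord ρ (wordTo x) Φ)      ≡⟨ evalWord-commutes ρ (wordTo x) i Φ ⟨
    evalWord ρ (wordTo x) (r i Φ)      ≡⟨ cong (evalWord ρ (wordTo x)) (standard i) ⟨
    evalWord ρ (wordTo x) (fun (ρ i) Φ) ∎)
    where open ≡-Reasoning

weight-vanishes : (f : Fin n → Parity) (w : Word n) →
                  (∀ j → parity (count j w) * f j ≡ 0ℙ) → weight f w ≡ 0ℙ
weight-vanishes {n} f w terms≡0ℙ =
  trans (weight≡∑ f w) (trans (sum-cong-≗ terms≡0ℙ) (sum-replicate-zero n))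

excluded : Subset n → Fin n → Parity
excluded I i with i ∈? I
... | yes _ = 0ℙ
... | no  _ = 1ℙ

excluded≡0ℙ⇔∈ : (I : Subset n) (i : Fin n) → (excluded I i ≡ 0ℙ) ⇔ (i ∈ I)
excluded≡0ℙ⇔∈ I i with i ∈? I
... | yes i∈I = mk⇔ (λ _ → i∈I) (λ _ → refl)
... | no  i∉I = mk⇔ (λ ()) (⊥-elim ∘ i∉I)

weight-excluded-vanishes : (I : Subset n) (w : Word n) → (∀ i → i ∉ I → 2 ∣ count i w) →
                           weight (excluded I) w ≡ 0ℙ
weight-excluded-vanishes I w even = weight-vanishes (excluded I) w term≡0ℙ
  where
  term≡0ℙ : ∀ j → parity (count j w) * excluded I j ≡ 0ℙ
  term≡0ℙ j with j ∈? I
  ... | yes _   = *-zeroʳ (parity (count j w))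
  ... | no  j∉I = cong (_* 1ℙ) (2∣⇒parity≡0ℙ (even j j∉I))

isOdd : Parity → Bool
isOdd 0ℙ = false
isOdd 1ℙ = true

isOdd-+-fixed⇔ : (p q : Parity) → (isOdd (p + q) ≡ isOdd q) ⇔ (p ≡ 0ℙ)
isOdd-+-fixed⇔ 0ℙ q  = mk⇔ (λ _ → refl) (λ _ → refl)
isOdd-+-fixed⇔ 1ℙ 0ℙ = mk⇔ (λ ()) (λ ())
isOdd-+-fixed⇔ 1ℙ 1ℙ = mk⇔ (λ ()) (λ ())

proposition5 : (n : ℕ) (F : Set) (r : Fin n → F → F) → IsManiplex n F r → IsRegular F r → (Φ : F) → (ρ : Fin n → Automorphism F r) → IsStandardGenerators Φ ρ → (R : Word n → Set) → IsPresentation ρ R → (I : Subset n) → (∀ i → i ∉ I → ∀ w → R w → 2 ∣ count i w) → ∃[ c ] IsBiColouring r I c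
proposition5 n F r M regular Φ ρ standard R presentation I even = isOdd ∘ colour , consistent
  where
  open ParityColouring M regular standard presentation (excluded I)
    (λ w Rw → weight-excluded-vanishes I w (λ i i∉I → even i i∉I w Rw))

  consistent : IsBiColouring r I (isOdd ∘ colour)
  consistent i x rewrite colour-adjacent i x =
    excluded≡0ℙ⇔∈ I i ⇔-∘ isOdd-+-fixed⇔ (excluded I i) (colour x)
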